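{- Let $m\in\mathbb{N}_{>0}$, $V$ a finite set, and $\mathcal{A}$ an $m$-dimensional abstract rigidity matroid on $K(V)$. Then for every $V'\subseteq V$ with $|V'|=m$, the set $\operatorname{bigstar}(V'):=K(V)\setminus K(V\setminus V')$ is a basis of $\mathcal{A}$.
   Context: For a finite set $W$, $K(W)=\{uv : u,v\in W, u\neq v\}$ is the edge set of the complete graph on $W$. For $E\subseteq K(V)$, $V(E)=\{u\in V: uw\in E \text{ for some } w\}$. For a matroid $\mathcal{A}$ on $K(V)$ with closure operator $\sigma$, a set $E\subseteq K(V)$ is rigid if $\sigma(E)=K(V(E))$. $\mathcal{A}$ is an $m$-dimensional abstract rigidity matroid if (C1) whenever $E,F\subseteq K(V)$ with $|V(E)\cap V(F)|<m$, then $\sigma(E\cup F)\subseteq K(V(E))\cup K(V(F))$; and (C2) whenever $E,F\subseteq K(V)$ are rigid with $|V(E)\cap V(F)|\geq m$, then $E\cup F$ is rigid. -}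

module Defs where

open import Data.Nat using (ℕ; _≤_) renaming (_<_ to _<ℕ_)
open import Data.Fin using (Fin; _<_; _<?_; _≟_)
open import Data.Fin.Subset using (Subset; _∩_; ∁; ∣_∣)
open import Data.Bool using (Bool; true; false; _∧_; _∨_; not)
open import Data.Vec using (lookup; tabulate)
open import Data.List using (allFin)
open import Data.Bool.ListAction using (any)
open import Data.Product using (Σ; _×_; _,_; proj₁; proj₂)
open import Relation.Nullary using (¬_; yes; no)
open import Relation.Nullary.Decidable using (⌊_⌋)
open import Relation.Binary.PropositionalEquality using (_≡_)

-- The vertex set V is Fin n.  An edge uv of K(V) is an unordered pair of
-- distinct vertices, represented canonically as (u , w) with w < u.
Edge : ℕ → Set
Edge n = Σ (Fin n × Fin n) (λ p → proj₂ p < proj₁ p)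

EdgeSet : ℕ → Set
EdgeSet n = Edge n → Bool

module _ {n : ℕ} where

  _∈E_ : Edge n → EdgeSet n → Set
  e ∈E E = E e ≡ true

  _⊆E_ : EdgeSet n → EdgeSet n → Set
  E ⊆E F = ∀ e → e ∈E E → e ∈E F

  _≐E_ : EdgeSet n → EdgeSet n → Set
  E ≐E F = (E ⊆E F) × (F ⊆E E)

  _∪E_ : EdgeSet n → EdgeSet n → EdgeSet n
  (E ∪E F) e = E e ∨ F e

  _≡ᵉ_ : Edge n → Edge n → Bool
  ((a , b) , _) ≡ᵉ ((c , d) , _) = ⌊ a ≟ c ⌋ ∧ ⌊ b ≟ d ⌋

  ⁅_⁆E : Edge n → EdgeSet n
  ⁅ e ⁆E f = f ≡ᵉ e

  _─E_ : EdgeSet n → Edge n → EdgeSet n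
  (E ─E e) f = E f ∧ not (f ≡ᵉ e)

  K : Subset n → EdgeSet n
  K W ((u , w) , _) = lookup W u ∧ lookup W w

  -- membership of the (unordered) pair {u,w} in E; false if u = w
  pairIn : EdgeSet n → Fin n → Fin n → Bool
  pairIn E u w with w <? u | u <? w
  ... | yes w<u | _       = E ((u , w) , w<u)
  ... | no _    | yes u<w = E ((w , u) , u<w)
  ... | no _    | no _    = false

  VE : EdgeSet n → Subset n
  VE E = tabulate (λ u → any (pairIn E u) (allFin n))

  -- bigstar(V') = K(V) ∖ K(V ∖ V')
  bigstar : Subset n → EdgeSet n
  bigstar V' e = not (K (∁ V') e)

-- A matroid on the ground set K(V), V = Fin n, given by its closure operator
-- (closure axioms; on a finite ground set these are equivalent to the usual
-- matroid axioms).
record Matroid (n : ℕ) : Set where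
  field
    σ           : EdgeSet n → EdgeSet n
    extensive   : ∀ X → X ⊆E σ X
    monotone    : ∀ X Y → X ⊆E Y → σ X ⊆E σ Y
    idempotent  : ∀ X → σ (σ X) ⊆E σ X
    exchange    : ∀ X e f → e ∈E σ (X ∪E ⁅ f ⁆E) → ¬ (e ∈E σ X) →
                  f ∈E σ (X ∪E ⁅ e ⁆E)

module _ {n : ℕ} (A : Matroid n) where
  open Matroid A

  Independent : EdgeSet n → Set
  Independent I = ∀ e → e ∈E I → ¬ (e ∈E σ (I ─E e))

  Basis : EdgeSet n → Set
  Basis B = Independent B × (∀ J → B ⊆E J → Independent J → J ⊆E B)

  Rigid : EdgeSet n → Set
  Rigid E = σ E ≐E K (VE E)

  record IsAbstractRigidityMatroid (m : ℕ) : Set where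
    field
      C1 : ∀ E F → ∣ VE E ∩ VE F ∣ <ℕ m →
           σ (E ∪E F) ⊆E (K (VE E) ∪E K (VE F))
      C2 : ∀ E F → Rigid E → Rigid F → m ≤ ∣ VE E ∩ VE F ∣ →
           Rigid (E ∪E F)

-- Write B = bigstar(V').  Maximality: an edge uv with u, v ∉ V' is spanned by B, because
-- K(V' ∪ {u}) and K(V' ∪ {v}) are rigid, lie in B and share the m vertices of V', so by
-- (C2) their union is rigid on a vertex set containing u and v.  Independence: if v ∉ V'
-- and c ∈ V', split B − vc into the edges at v and the rest; their vertex sets meet only
-- in V' − {c}, fewer than m vertices, so by (C1) vc is not spanned.  The same split shows
-- that K(V') is independent, and an edge of K(V') stays unspanned while the remaining
-- edges of B are added one at a time, by the exchange axiom.
module Submission where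

open import Defs
open import Data.Bool using (true; false; _∧_; _∨_; not)
import Data.Bool as Bool
open import Data.Bool.Properties using (∧-conicalˡ; ∧-conicalʳ; T-≡)
open import Data.Empty using (⊥-elim)
open import Data.Fin using (Fin; _<?_; _≟_)
open import Data.Fin.Properties using (<-irrelevant; <-irrefl; <-asym; <-cmp)
open import Data.Fin.Subset using (Subset; ∣_∣; _∈_; _∉_; _⊆_; _∩_; _∪_; ⁅_⁆; ∁; ⊥; Nonempty)
open import Data.Fin.Subset.Properties
  using (_∈?_; x∈p∩q⁺; x∈p∩q⁻; x∈p∪q⁺; x∈p∪q⁻; x∈⁅x⁆; x∈⁅y⁆⇒x≡y; x∈p⇒x∉∁p; x∉p⇒x∈∁p;
         p⊆q⇒∣p∣≤∣q∣; p⊂q⇒∣p∣<∣q∣; ∣⊥∣≡0; nonempty?; Empty-unique)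
open import Data.List using (List; []; _∷_; allFin; concatMap)
open import Data.List.Membership.Propositional using (lose) renaming (_∈_ to _∈ₗ_)
open import Data.List.Membership.Propositional.Properties using (∈-allFin; ∈-concatMap⁺)
open import Data.List.Relation.Unary.Any using (here; there; satisfied)
open import Data.List.Relation.Unary.Any.Properties using (any⁺; any⁻)
open import Data.Nat using (ℕ; _<_; _≤_)
open import Data.Nat.Properties using (≤-reflexive; ≤-trans; <-≤-trans; ≤-<-trans)
open import Data.Product using (∃; _×_; _,_; proj₁; proj₂)
open import Data.Sum using (_⊎_; inj₁; inj₂; [_,_])
open import Data.Vec.Properties using ([]=⇒lookup; lookup⇒[]=; lookup∘tabulate)
open import Function using (id; _∘_; Equivalence)
open import Relation.Binary.Definitions using (tri<; tri≈; tri>)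
open import Relation.Binary.PropositionalEquality using (_≡_; _≢_; refl; sym; trans; cong; cong₂; subst)
open import Relation.Nullary using (¬_; Dec; yes; no; contradiction)
open import Relation.Nullary.Decidable using (⌊_⌋)

private
  ≟-true⁻ : ∀ {n} (a b : Fin n) → ⌊ a ≟ b ⌋ ≡ true → a ≡ b
  ≟-true⁻ a b _ with a ≟ b
  ... | yes a≡b = a≡b

  ≟-true⁺ : ∀ {n} (a b : Fin n) → a ≡ b → ⌊ a ≟ b ⌋ ≡ true
  ≟-true⁺ a b a≡b with a ≟ b
  ... | yes _ = refl
  ... | no a≢b = contradiction a≡b a≢b

  not-true⁻ : ∀ {b} → not b ≡ true → b ≢ true
  not-true⁻ {true} () refl

  not-true⁺ : ∀ {b} → b ≢ true → not b ≡ true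
  not-true⁺ {true} b≢true = contradiction refl b≢true
  not-true⁺ {false} _ = refl

  ∨-true⁻ : ∀ {a b} → a ∨ b ≡ true → a ≡ true ⊎ b ≡ true
  ∨-true⁻ {true} _ = inj₁ refl
  ∨-true⁻ {false} b≡true = inj₂ b≡true

  ∨-trueʳ : ∀ {a b} → b ≡ true → a ∨ b ≡ true
  ∨-trueʳ {true} _ = refl
  ∨-trueʳ {false} b≡true = b≡true

  ∧-true⁺ : ∀ {a b} → a ≡ true → b ≡ true → a ∧ b ≡ true
  ∧-true⁺ refl refl = refl

∣p∣>0⇒Nonempty : ∀ {n} {p : Subset n} → 0 < ∣ p ∣ → Nonempty p
∣p∣>0⇒Nonempty {n} {p} 0<∣p∣ with nonempty? p
... | yes p≢∅ = p≢∅
... | no p≡∅ = contradiction (subst (λ q → 0 < ∣ q ∣) (Empty-unique p≡∅) 0<∣p∣)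
                             (subst (¬_ ∘ (0 <_)) (sym (∣⊥∣≡0 n)) λ ())

module _ {n : ℕ} where

  src tgt : Edge n → Fin n
  src e = proj₁ (proj₁ e)
  tgt e = proj₂ (proj₁ e)

  Incident : Edge n → Fin n → Set
  Incident e v = src e ≡ v ⊎ tgt e ≡ v

  Joins : Edge n → Fin n → Fin n → Set
  Joins e u w = (src e ≡ u × tgt e ≡ w) ⊎ (src e ≡ w × tgt e ≡ u)

  edge-≡ : ∀ {e f : Edge n} → src e ≡ src f → tgt e ≡ tgt f → e ≡ f
  edge-≡ {(a , b) , p} {(a , b) , q} refl refl = cong (λ r → (a , b) , r) (<-irrelevant p q)

  ≡ᵉ⇒≡ : ∀ {e f : Edge n} → (e ≡ᵉ f) ≡ true → e ≡ f
  ≡ᵉ⇒≡ {(a , b) , _} {(c , d) , _} h =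
    edge-≡ (≟-true⁻ a c (∧-conicalˡ _ _ h)) (≟-true⁻ b d (∧-conicalʳ _ _ h))

  ≡⇒≡ᵉ : ∀ {e f : Edge n} → e ≡ f → (e ≡ᵉ f) ≡ true
  ≡⇒≡ᵉ {(a , b) , _} refl = ∧-true⁺ (≟-true⁺ a a refl) (≟-true⁺ b b refl)

  Joins-incidentˡ : ∀ {e u w} → Joins e u w → Incident e u
  Joins-incidentˡ (inj₁ (s≡u , _)) = inj₁ s≡u
  Joins-incidentˡ (inj₂ (_ , t≡u)) = inj₂ t≡u

  Joins-incidentʳ : ∀ {e u w} → Joins e u w → Incident e w
  Joins-incidentʳ (inj₁ (_ , t≡w)) = inj₂ t≡w
  Joins-incidentʳ (inj₂ (s≡w , _)) = inj₁ s≡w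

  incident⇒Joins : ∀ {e u w} → u ≢ w → Incident e u → Incident e w → Joins e u w
  incident⇒Joins u≢w (inj₁ refl) (inj₁ refl) = contradiction refl u≢w
  incident⇒Joins u≢w (inj₁ s≡u) (inj₂ t≡w) = inj₁ (s≡u , t≡w)
  incident⇒Joins u≢w (inj₂ t≡u) (inj₁ s≡w) = inj₂ (s≡w , t≡u)
  incident⇒Joins u≢w (inj₂ refl) (inj₂ refl) = contradiction refl u≢w

  incident⇒Joins-other : ∀ {e v} → Incident e v → ∃ λ w → Joins e v w
  incident⇒Joins-other (inj₁ refl) = _ , inj₁ (refl , refl)
  incident⇒Joins-other (inj₂ refl) = _ , inj₂ (refl , refl)

  Joins-distinct : ∀ {e u w} → Joins e u w → u ≢ w
  Joins-distinct {e} (inj₁ (refl , refl)) refl = <-irrefl refl (proj₂ e)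
  Joins-distinct {e} (inj₂ (refl , refl)) refl = <-irrefl refl (proj₂ e)

  Joins-unique : ∀ {e f u w} → Joins e u w → Joins f u w → e ≡ f
  Joins-unique (inj₁ (refl , refl)) (inj₁ (s , t)) = edge-≡ (sym s) (sym t)
  Joins-unique (inj₂ (refl , refl)) (inj₂ (s , t)) = edge-≡ (sym s) (sym t)
  Joins-unique {e} {f} (inj₁ (refl , refl)) (inj₂ (refl , refl)) = contradiction (proj₂ e) (<-asym (proj₂ f))
  Joins-unique {e} {f} (inj₂ (refl , refl)) (inj₁ (refl , refl)) = contradiction (proj₂ e) (<-asym (proj₂ f))

  joining : ∀ {u w} → u ≢ w → ∃ λ e → Joins e u w
  joining {u} {w} u≢w with <-cmp u w
  ... | tri< u<w _ _ = ((w , u) , u<w) , inj₂ (refl , refl)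
  ... | tri≈ _ u≡w _ = contradiction u≡w u≢w
  ... | tri> _ _ w<u = ((u , w) , w<u) , inj₁ (refl , refl)

  ∅E : EdgeSet n
  ∅E _ = false

  _∩E_ : EdgeSet n → EdgeSet n → EdgeSet n
  (E ∩E F) e = E e ∧ F e

  ∁E : EdgeSet n → EdgeSet n
  ∁E E e = not (E e)

  star : Fin n → EdgeSet n
  star v e = ⌊ src e ≟ v ⌋ ∨ ⌊ tgt e ≟ v ⌋

  fromList : List (Edge n) → EdgeSet n
  fromList [] = ∅E
  fromList (f ∷ L) = ⁅ f ⁆E ∪E fromList L

  _∈E?_ : ∀ e (E : EdgeSet n) → Dec (e ∈E E)
  e ∈E? E = E e Bool.≟ true

  ∈∪E⁻ : ∀ (E F : EdgeSet n) e → e ∈E (E ∪E F) → e ∈E E ⊎ e ∈E F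
  ∈∪E⁻ _ _ _ = ∨-true⁻

  ⊆∪Eˡ : ∀ (E F : EdgeSet n) → E ⊆E (E ∪E F)
  ⊆∪Eˡ E F e = cong (_∨ F e)

  ⊆∪Eʳ : ∀ (E F : EdgeSet n) → F ⊆E (E ∪E F)
  ⊆∪Eʳ _ _ _ = ∨-trueʳ

  ∈∩E⁺ : ∀ (E F : EdgeSet n) e → e ∈E E → e ∈E F → e ∈E (E ∩E F)
  ∈∩E⁺ _ _ _ = ∧-true⁺

  ∈∩E⁻ : ∀ (E F : EdgeSet n) e → e ∈E (E ∩E F) → e ∈E E × e ∈E F
  ∈∩E⁻ _ _ _ h = ∧-conicalˡ _ _ h , ∧-conicalʳ _ _ h

  ∈∁E⁺ : ∀ (E : EdgeSet n) e → ¬ e ∈E E → e ∈E ∁E E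
  ∈∁E⁺ _ _ = not-true⁺

  ∈∁E⁻ : ∀ (E : EdgeSet n) e → e ∈E ∁E E → ¬ e ∈E E
  ∈∁E⁻ _ _ = not-true⁻

  ∈─E⁺ : ∀ (E : EdgeSet n) e f → e ∈E E → e ≢ f → e ∈E (E ─E f)
  ∈─E⁺ _ _ _ e∈E e≢f = ∧-true⁺ e∈E (not-true⁺ (e≢f ∘ ≡ᵉ⇒≡))

  ∈─E⁻ : ∀ (E : EdgeSet n) e f → e ∈E (E ─E f) → e ∈E E × e ≢ f
  ∈─E⁻ _ _ _ h = ∧-conicalˡ _ _ h , not-true⁻ (∧-conicalʳ _ _ h) ∘ ≡⇒≡ᵉ

  ∈⁅⁆E : ∀ e → e ∈E ⁅ e ⁆E
  ∈⁅⁆E e = ≡⇒≡ᵉ {e} refl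

  ∈⁅⁆E⁻ : ∀ e f → e ∈E ⁅ f ⁆E → e ≡ f
  ∈⁅⁆E⁻ _ _ = ≡ᵉ⇒≡

  ∈star⁺ : ∀ e v → Incident e v → e ∈E star v
  ∈star⁺ e v (inj₁ s≡v) = cong (_∨ ⌊ tgt e ≟ v ⌋) (≟-true⁺ (src e) v s≡v)
  ∈star⁺ e v (inj₂ t≡v) = ∨-trueʳ (≟-true⁺ (tgt e) v t≡v)

  ∈star⁻ : ∀ e v → e ∈E star v → Incident e v
  ∈star⁻ e v h with ∨-true⁻ h
  ... | inj₁ s≡v = inj₁ (≟-true⁻ (src e) v s≡v)
  ... | inj₂ t≡v = inj₂ (≟-true⁻ (tgt e) v t≡v)

  ⊆E-split : ∀ (E F : EdgeSet n) → E ⊆E ((E ∩E ∁E F) ∪E (E ∩E F))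
  ⊆E-split E F e e∈E with e ∈E? F
  ... | yes e∈F = ⊆∪Eʳ (E ∩E ∁E F) (E ∩E F) e (∈∩E⁺ E F e e∈E e∈F)
  ... | no e∉F = ⊆∪Eˡ (E ∩E ∁E F) (E ∩E F) e (∈∩E⁺ E (∁E F) e e∈E (∈∁E⁺ F e e∉F))

  ∈fromList⁺ : ∀ {e L} → e ∈ₗ L → e ∈E fromList L
  ∈fromList⁺ {e} {_ ∷ L} (here refl) = ⊆∪Eˡ ⁅ e ⁆E (fromList L) e (∈⁅⁆E e)
  ∈fromList⁺ {e} {f ∷ L} (there e∈L) = ⊆∪Eʳ ⁅ f ⁆E (fromList L) e (∈fromList⁺ e∈L)

  edgesBetween : Fin n → Fin n → List (Edge n)
  edgesBetween u w with w <? u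
  ... | yes w<u = ((u , w) , w<u) ∷ []
  ... | no _ = []

  allEdges : List (Edge n)
  allEdges = concatMap (λ u → concatMap (edgesBetween u) (allFin n)) (allFin n)

  ∈-allEdges : ∀ e → e ∈ₗ allEdges
  ∈-allEdges e@((u , w) , w<u) =
    ∈-concatMap⁺ (λ u → concatMap (edgesBetween u) (allFin n))
      (lose (∈-allFin u) (∈-concatMap⁺ (edgesBetween u) (lose (∈-allFin w) ∈-edgesBetween)))
    where
      ∈-edgesBetween : e ∈ₗ edgesBetween u w
      ∈-edgesBetween with w <? u
      ... | yes _ = here (edge-≡ refl refl)
      ... | no w≮u = contradiction w<u w≮u

  ∈K⁺ : ∀ (W : Subset n) e → src e ∈ W → tgt e ∈ W → e ∈E K W
  ∈K⁺ _ _ s∈W t∈W = cong₂ _∧_ ([]=⇒lookup s∈W) ([]=⇒lookup t∈W)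

  ∈K⁻ : ∀ (W : Subset n) e {v} → e ∈E K W → Incident e v → v ∈ W
  ∈K⁻ W ((u , _) , _) h (inj₁ refl) = lookup⇒[]= u W (∧-conicalˡ _ _ h)
  ∈K⁻ W ((_ , w) , _) h (inj₂ refl) = lookup⇒[]= w W (∧-conicalʳ _ _ h)

  Joins⇒∈K : ∀ (W : Subset n) e {u w} → Joins e u w → u ∈ W → w ∈ W → e ∈E K W
  Joins⇒∈K W e (inj₁ (refl , refl)) u∈W w∈W = ∈K⁺ W e u∈W w∈W
  Joins⇒∈K W e (inj₂ (refl , refl)) u∈W w∈W = ∈K⁺ W e w∈W u∈W

  pairIn⇒incident : ∀ (E : EdgeSet n) {u w} → pairIn E u w ≡ true → ∃ λ e → e ∈E E × Incident e u
  pairIn⇒incident E {u} {w} h with w <? u | u <? w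
  ... | yes w<u | _ = ((u , w) , w<u) , h , inj₁ refl
  ... | no _ | yes u<w = ((w , u) , u<w) , h , inj₂ refl

  Joins⇒pairIn : ∀ (E : EdgeSet n) e {u w} → e ∈E E → Joins e u w → pairIn E u w ≡ true
  Joins⇒pairIn E ((a , b) , b<a) h (inj₁ (refl , refl)) with b <? a
  ... | yes _ = trans (cong E (edge-≡ refl refl)) h
  ... | no b≮a = contradiction b<a b≮a
  Joins⇒pairIn E ((a , b) , b<a) h (inj₂ (refl , refl)) with a <? b | b <? a
  ... | yes a<b | _ = contradiction a<b (<-asym b<a)
  ... | no _ | yes _ = trans (cong E (edge-≡ refl refl)) h
  ... | no _ | no b≮a = contradiction b<a b≮a

  ∈VE⁻ : ∀ (E : EdgeSet n) {v} → v ∈ VE E → ∃ λ e → e ∈E E × Incident e v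
  ∈VE⁻ E {v} v∈VE = pairIn⇒incident E (Equivalence.to T-≡ (proj₂ (satisfied (any⁻ (pairIn E v) (allFin n)
    (Equivalence.from T-≡ (trans (sym (lookup∘tabulate _ v)) ([]=⇒lookup v∈VE)))))))

  ∈VE⁺ : ∀ (E : EdgeSet n) e {v} → e ∈E E → Incident e v → v ∈ VE E
  ∈VE⁺ E e {v} e∈E e∋v with incident⇒Joins-other {e} e∋v
  ... | w , e-vw = lookup⇒[]= v (VE E) (trans (lookup∘tabulate _ v) (Equivalence.to T-≡
    (any⁺ (pairIn E v) (lose (∈-allFin w) (Equivalence.from T-≡ (Joins⇒pairIn E e e∈E e-vw))))))

  VE-mono : ∀ {E F : EdgeSet n} → E ⊆E F → VE E ⊆ VE F
  VE-mono {E} {F} E⊆F v∈VE with ∈VE⁻ E v∈VE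
  ... | e , e∈E , e∋v = ∈VE⁺ F e (E⊆F e e∈E) e∋v

  VE-K⊆ : ∀ (W : Subset n) → VE (K W) ⊆ W
  VE-K⊆ W v∈VE with ∈VE⁻ (K W) v∈VE
  ... | e , e∈K , e∋v = ∈K⁻ W e e∈K e∋v

  ∈VE-K : ∀ (W : Subset n) {u w} → u ∈ W → w ∈ W → u ≢ w → u ∈ VE (K W)
  ∈VE-K W u∈W w∈W u≢w with joining u≢w
  ... | e , e-uw = ∈VE⁺ (K W) e (Joins⇒∈K W e e-uw u∈W w∈W) (Joins-incidentˡ {e} e-uw)

  ∉VE-∅E : ∀ {v} → v ∉ VE ∅E
  ∉VE-∅E v∈VE with ∈VE⁻ ∅E v∈VE
  ... | _ , () , _

  ∈bigstar⁺ : ∀ (V' : Subset n) e {v} → Incident e v → v ∈ V' → e ∈E bigstar V'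
  ∈bigstar⁺ V' e e∋v v∈V' = not-true⁺ λ e∈K∁ → x∈p⇒x∉∁p v∈V' (∈K⁻ (∁ V') e e∈K∁ e∋v)

  ∈bigstar⁻ : ∀ (V' : Subset n) e → e ∈E bigstar V' → src e ∈ V' ⊎ tgt e ∈ V'
  ∈bigstar⁻ V' e h with src e ∈? V' | tgt e ∈? V'
  ... | yes s∈V' | _ = inj₁ s∈V'
  ... | no _ | yes t∈V' = inj₂ t∈V'
  ... | no s∉V' | no t∉V' = contradiction (∈K⁺ (∁ V') e (x∉p⇒x∈∁p s∉V') (x∉p⇒x∈∁p t∉V')) (not-true⁻ h)

  K-∪⁅⁆⊆bigstar : ∀ (V' : Subset n) u → K (V' ∪ ⁅ u ⁆) ⊆E bigstar V'
  K-∪⁅⁆⊆bigstar V' u e e∈K with x∈p∪q⁻ V' ⁅ u ⁆ (∈K⁻ _ e e∈K (inj₁ refl))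
                               | x∈p∪q⁻ V' ⁅ u ⁆ (∈K⁻ _ e e∈K (inj₂ refl))
  ... | inj₁ s∈V' | _ = ∈bigstar⁺ V' e (inj₁ refl) s∈V'
  ... | inj₂ _ | inj₁ t∈V' = ∈bigstar⁺ V' e (inj₂ refl) t∈V'
  ... | inj₂ s∈⁅u⁆ | inj₂ t∈⁅u⁆ =
    contradiction (proj₂ e) (<-irrefl (trans (x∈⁅y⁆⇒x≡y u t∈⁅u⁆) (sym (x∈⁅y⁆⇒x≡y u s∈⁅u⁆))))

module _ {n : ℕ} (A : Matroid n) where
  open Matroid A

  ∉σ-⊆ : ∀ {E F x} → E ⊆E F → ¬ x ∈E σ F → ¬ x ∈E σ E
  ∉σ-⊆ {E} {F} {x} E⊆F x∉σF = x∉σF ∘ monotone E F E⊆F x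

  ∉σ-∪⁅⁆ : ∀ {U S x f} → ¬ x ∈E σ S → ¬ f ∈E σ (U ─E f) → (S ∪E ⁅ x ⁆E) ⊆E (U ─E f) →
           ¬ x ∈E σ (S ∪E ⁅ f ⁆E)
  ∉σ-∪⁅⁆ {U} {S} {x} {f} x∉σS f∉σU-f S+x⊆U-f x∈σS+f =
    f∉σU-f (monotone (S ∪E ⁅ x ⁆E) (U ─E f) S+x⊆U-f f (exchange S x f x∈σS+f x∉σS))

  -- Elements of U are added to S one at a time, in the order of allEdges; ∉σ-∪⁅⁆ keeps x unspanned.
  module _ {U S : EdgeSet n} {x : Edge n} (x∈U : x ∈E U) (S⊆U : S ⊆E U)
           (others-free : ∀ {f} → f ∈E (U ─E x) → ¬ f ∈E S → ¬ f ∈E σ (U ─E f)) where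

    private
      grow : List (Edge n) → EdgeSet n
      grow L = S ∪E (fromList L ∩E (U ─E x))

      S⊆grow : ∀ L → S ⊆E grow L
      S⊆grow L = ⊆∪Eˡ S (fromList L ∩E (U ─E x))

      grow⊆U : ∀ L → grow L ⊆E U
      grow⊆U L e h with ∈∪E⁻ S (fromList L ∩E (U ─E x)) e h
      ... | inj₁ e∈S = S⊆U e e∈S
      ... | inj₂ e∈L∩U-x = proj₁ (∈─E⁻ U e x (proj₂ (∈∩E⁻ (fromList L) (U ─E x) e e∈L∩U-x)))

      ∈grow-∷⁻ : ∀ f L e → e ∈E grow (f ∷ L) → e ∈E grow L ⊎ (e ≡ f × e ∈E (U ─E x))
      ∈grow-∷⁻ f L e h with ∈∪E⁻ S (fromList (f ∷ L) ∩E (U ─E x)) e h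
      ... | inj₁ e∈S = inj₁ (S⊆grow L e e∈S)
      ... | inj₂ e∈fL∩U-x with ∈∩E⁻ (fromList (f ∷ L)) (U ─E x) e e∈fL∩U-x
      ...   | e∈fL , e∈U-x with ∈∪E⁻ ⁅ f ⁆E (fromList L) e e∈fL
      ...     | inj₁ e∈⁅f⁆ = inj₂ (∈⁅⁆E⁻ e f e∈⁅f⁆ , e∈U-x)
      ...     | inj₂ e∈L = inj₁ (⊆∪Eʳ S (fromList L ∩E (U ─E x)) e (∈∩E⁺ (fromList L) (U ─E x) e e∈L e∈U-x))

      grow-∷⊆grow : ∀ f L → (f ∈E (U ─E x) → f ∈E grow L) → grow (f ∷ L) ⊆E grow L
      grow-∷⊆grow f L f∈grow e h with ∈grow-∷⁻ f L e h
      ... | inj₁ e∈grow = e∈grow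
      ... | inj₂ (refl , e∈U-x) = f∈grow e∈U-x

      ∉σ-grow-∷ : ∀ f L → ¬ x ∈E σ (grow L) → ¬ x ∈E σ (grow (f ∷ L))
      ∉σ-grow-∷ f L x∉σ with f ∈E? grow L | f ∈E? (U ─E x)
      ... | yes f∈grow | _ = ∉σ-⊆ (grow-∷⊆grow f L λ _ → f∈grow) x∉σ
      ... | no _ | no f∉U-x = ∉σ-⊆ (grow-∷⊆grow f L λ f∈U-x → contradiction f∈U-x f∉U-x) x∉σ
      ... | no f∉grow | yes f∈U-x = ∉σ-⊆ grow-∷⊆grow+f (∉σ-∪⁅⁆ x∉σ f∉σU-f grow+x⊆U-f)
        where
          grow-∷⊆grow+f : grow (f ∷ L) ⊆E (grow L ∪E ⁅ f ⁆E)
          grow-∷⊆grow+f e h with ∈grow-∷⁻ f L e h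
          ... | inj₁ e∈grow = ⊆∪Eˡ (grow L) ⁅ f ⁆E e e∈grow
          ... | inj₂ (refl , _) = ⊆∪Eʳ (grow L) ⁅ f ⁆E e (∈⁅⁆E e)

          f∉σU-f : ¬ f ∈E σ (U ─E f)
          f∉σU-f = others-free f∈U-x (f∉grow ∘ S⊆grow L f)

          grow+x⊆U-f : (grow L ∪E ⁅ x ⁆E) ⊆E (U ─E f)
          grow+x⊆U-f e h with ∈∪E⁻ (grow L) ⁅ x ⁆E e h
          ... | inj₁ e∈grow = ∈─E⁺ U e f (grow⊆U L e e∈grow) λ { refl → f∉grow e∈grow }
          ... | inj₂ e∈⁅x⁆ with ∈⁅⁆E⁻ e x e∈⁅x⁆
          ...   | refl = ∈─E⁺ U e f x∈U λ { refl → proj₂ (∈─E⁻ U f x f∈U-x) refl }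

      ∉σ-grow : ¬ x ∈E σ S → ∀ L → ¬ x ∈E σ (grow L)
      ∉σ-grow x∉σS [] = ∉σ-⊆ grow[]⊆S x∉σS
        where
          grow[]⊆S : grow [] ⊆E S
          grow[]⊆S e h with ∈∪E⁻ S (∅E ∩E (U ─E x)) e h
          ... | inj₁ e∈S = e∈S
          ... | inj₂ ()
      ∉σ-grow x∉σS (f ∷ L) = ∉σ-grow-∷ f L (∉σ-grow x∉σS L)

    ∉σ-─ : ¬ x ∈E σ S → ¬ x ∈E σ (U ─E x)
    ∉σ-─ x∉σS = ∉σ-⊆ U-x⊆grow (∉σ-grow x∉σS allEdges)
      where
        U-x⊆grow : (U ─E x) ⊆E grow allEdges
        U-x⊆grow e e∈U-x = ⊆∪Eʳ S (fromList allEdges ∩E (U ─E x)) e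
          (∈∩E⁺ (fromList allEdges) (U ─E x) e (∈fromList⁺ (∈-allEdges e)) e∈U-x)

module _ {n m : ℕ} {A : Matroid n} (R : IsAbstractRigidityMatroid A m) where
  open Matroid A
  open IsAbstractRigidityMatroid R

  σ⊆K-VE : 0 < m → ∀ (E : EdgeSet n) → σ E ⊆E K (VE E)
  σ⊆K-VE 0<m E e e∈σE =
    [ id , (λ e∈K∅ → contradiction (∈K⁻ (VE ∅E) e e∈K∅ (inj₁ refl)) ∉VE-∅E) ]
      (∈∪E⁻ (K (VE E)) (K (VE ∅E)) e
        (C1 E ∅E ∣VE∩VE∅∣<m e (monotone E (E ∪E ∅E) (⊆∪Eˡ E ∅E) e e∈σE)))
    where
      ∣VE∩VE∅∣<m : ∣ VE E ∩ VE ∅E ∣ < m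
      ∣VE∩VE∅∣<m = ≤-<-trans
        (p⊆q⇒∣p∣≤∣q∣ {q = ⊥} λ v∈∩ → contradiction (proj₂ (x∈p∩q⁻ (VE E) (VE ∅E) v∈∩)) ∉VE-∅E)
        (subst (_< m) (sym (∣⊥∣≡0 n)) 0<m)

  K-rigid : 0 < m → ∀ (W : Subset n) → Rigid A (K W)
  K-rigid 0<m W = σ⊆K-VE 0<m (K W) , λ e e∈KVE →
    extensive (K W) e (∈K⁺ W e (VE-K⊆ W (∈K⁻ _ e e∈KVE (inj₁ refl)))
                               (VE-K⊆ W (∈K⁻ _ e e∈KVE (inj₂ refl))))

  -- The edges of D − f at v and the remaining ones have vertex sets meeting inside W − {c}.
  ∉σ-at-sparse-vertex : ∀ {D W f v c} → Joins f v c → c ∈ W → ∣ W ∣ ≤ m →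
                        (∀ {e i} → e ∈E D → Joins e v i → i ∈ W) → ¬ f ∈E σ (D ─E f)
  ∉σ-at-sparse-vertex {D} {W} {f} {v} {c} f-vc c∈W ∣W∣≤m neighbours∈W f∈σ =
    [ (λ f∈KVP → v∉VP (∈K⁻ (VE P) f f∈KVP (Joins-incidentˡ {e = f} f-vc)))
    , (λ f∈KVQ → c∉VQ (∈K⁻ (VE Q) f f∈KVQ (Joins-incidentʳ {e = f} f-vc)))
    ] (∈∪E⁻ (K (VE P)) (K (VE Q)) f f∈K∪K)
    where
      P Q : EdgeSet n
      P = (D ─E f) ∩E ∁E (star v)
      Q = (D ─E f) ∩E star v

      v∉VP : v ∉ VE P
      v∉VP v∈VP with ∈VE⁻ P v∈VP
      ... | e , e∈P , e∋v = ∈∁E⁻ (star v) e (proj₂ (∈∩E⁻ (D ─E f) (∁E (star v)) e e∈P)) (∈star⁺ e v e∋v)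

      VQ-neighbour : ∀ {i} → i ∈ VE Q → i ≢ v → ∃ λ e → e ∈E (D ─E f) × Joins e v i
      VQ-neighbour {i} i∈VQ i≢v with ∈VE⁻ Q i∈VQ
      ... | e , e∈Q , e∋i with ∈∩E⁻ (D ─E f) (star v) e e∈Q
      ...   | e∈D-f , e∈star = e , e∈D-f , incident⇒Joins {e = e} (i≢v ∘ sym) (∈star⁻ e v e∈star) e∋i

      c∉VQ : c ∉ VE Q
      c∉VQ c∈VQ with VQ-neighbour c∈VQ (Joins-distinct {e = f} f-vc ∘ sym)
      ... | e , e∈D-f , e-vc = proj₂ (∈─E⁻ D e f e∈D-f) (Joins-unique {e = e} {f = f} e-vc f-vc)

      VP∩VQ⊆W : VE P ∩ VE Q ⊆ W
      VP∩VQ⊆W i∈∩ with x∈p∩q⁻ (VE P) (VE Q) i∈∩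
      ... | i∈VP , i∈VQ with VQ-neighbour i∈VQ (λ { refl → v∉VP i∈VP })
      ...   | e , e∈D-f , e-vi = neighbours∈W (proj₁ (∈─E⁻ D e f e∈D-f)) e-vi

      ∣VP∩VQ∣<m : ∣ VE P ∩ VE Q ∣ < m
      ∣VP∩VQ∣<m =
        <-≤-trans (p⊂q⇒∣p∣<∣q∣ (VP∩VQ⊆W , c , c∈W , c∉VQ ∘ proj₂ ∘ x∈p∩q⁻ (VE P) (VE Q))) ∣W∣≤m

      f∈K∪K : f ∈E (K (VE P) ∪E K (VE Q))
      f∈K∪K = C1 P Q ∣VP∩VQ∣<m f (monotone (D ─E f) (P ∪E Q) (⊆E-split (D ─E f) (star v)) f f∈σ)

  ∈σ-K∪K : 0 < m → ∀ {W u w e} → m ≤ ∣ W ∣ → u ∉ W → w ∉ W → Joins e u w →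
           e ∈E σ (K (W ∪ ⁅ u ⁆) ∪E K (W ∪ ⁅ w ⁆))
  ∈σ-K∪K 0<m {W} {u} {w} {e} m≤∣W∣ u∉W w∉W e-uw =
    proj₂ rigid e (Joins⇒∈K (VE (Ku ∪E Kw)) e e-uw (VE-mono (⊆∪Eˡ Ku Kw) (x∈VE u∉W))
                                                   (VE-mono (⊆∪Eʳ Ku Kw) (x∈VE w∉W)))
    where
      Ku Kw : EdgeSet n
      Ku = K (W ∪ ⁅ u ⁆)
      Kw = K (W ∪ ⁅ w ⁆)

      a∈W : proj₁ (∣p∣>0⇒Nonempty (<-≤-trans 0<m m≤∣W∣)) ∈ W
      a∈W = proj₂ (∣p∣>0⇒Nonempty (<-≤-trans 0<m m≤∣W∣))

      W⊆VE : ∀ {x} → x ∉ W → W ⊆ VE (K (W ∪ ⁅ x ⁆))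
      W⊆VE {x} x∉W i∈W = ∈VE-K _ (x∈p∪q⁺ (inj₁ i∈W)) (x∈p∪q⁺ (inj₂ (x∈⁅x⁆ x))) λ { refl → x∉W i∈W }

      x∈VE : ∀ {x} → x ∉ W → x ∈ VE (K (W ∪ ⁅ x ⁆))
      x∈VE {x} x∉W = ∈VE-K _ (x∈p∪q⁺ (inj₂ (x∈⁅x⁆ x))) (x∈p∪q⁺ (inj₁ a∈W)) λ { refl → x∉W a∈W }

      rigid : Rigid A (Ku ∪E Kw)
      rigid = C2 Ku Kw (K-rigid 0<m (W ∪ ⁅ u ⁆)) (K-rigid 0<m (W ∪ ⁅ w ⁆))
        (≤-trans m≤∣W∣ (p⊆q⇒∣p∣≤∣q∣ λ i∈W → x∈p∩q⁺ (W⊆VE u∉W i∈W , W⊆VE w∉W i∈W)))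

  module _ {V' : Subset n} where

    bigstar-spans : 0 < m → m ≤ ∣ V' ∣ → ∀ e → ¬ e ∈E bigstar V' → e ∈E σ (bigstar V')
    bigstar-spans 0<m m≤∣V'∣ e e∉B =
      monotone (K (V' ∪ ⁅ src e ⁆) ∪E K (V' ∪ ⁅ tgt e ⁆)) (bigstar V') K∪K⊆B e
        (∈σ-K∪K 0<m m≤∣V'∣ (e∉B ∘ ∈bigstar⁺ V' e (inj₁ refl)) (e∉B ∘ ∈bigstar⁺ V' e (inj₂ refl))
                (inj₁ (refl , refl)))
      where
        K∪K⊆B : (K (V' ∪ ⁅ src e ⁆) ∪E K (V' ∪ ⁅ tgt e ⁆)) ⊆E bigstar V'
        K∪K⊆B f f∈K∪K = [ K-∪⁅⁆⊆bigstar V' (src e) f , K-∪⁅⁆⊆bigstar V' (tgt e) f ]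
          (∈∪E⁻ (K (V' ∪ ⁅ src e ⁆)) (K (V' ∪ ⁅ tgt e ⁆)) f f∈K∪K)

    bigstar-maximal : 0 < m → m ≤ ∣ V' ∣ → ∀ J → bigstar V' ⊆E J → Independent A J → J ⊆E bigstar V'
    bigstar-maximal 0<m m≤∣V'∣ J B⊆J J-independent e e∈J with e ∈E? bigstar V'
    ... | yes e∈B = e∈B
    ... | no e∉B = contradiction (monotone (bigstar V') (J ─E e) B⊆J-e e (bigstar-spans 0<m m≤∣V'∣ e e∉B))
                                 (J-independent e e∈J)
      where
        B⊆J-e : bigstar V' ⊆E (J ─E e)
        B⊆J-e f f∈B = ∈─E⁺ J f e (B⊆J f f∈B) λ { refl → e∉B f∈B }

    ∉σ-K-─ : ∣ V' ∣ ≤ m → ∀ {x} → x ∈E K V' → ¬ x ∈E σ (K V' ─E x)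
    ∉σ-K-─ ∣V'∣≤m {x} x∈K =
      ∉σ-at-sparse-vertex {K V'} {V'} {x} (inj₂ (refl , refl)) (∈K⁻ V' x x∈K (inj₁ refl)) ∣V'∣≤m
        λ {e} e∈K e-vi → ∈K⁻ V' e e∈K (Joins-incidentʳ {e = e} e-vi)

    ∉σ-bigstar-outer : ∣ V' ∣ ≤ m → ∀ {f v c} → Joins f v c → v ∉ V' → c ∈ V' →
                       ¬ f ∈E σ (bigstar V' ─E f)
    ∉σ-bigstar-outer ∣V'∣≤m {f} {v} {c} f-vc v∉V' c∈V' =
      ∉σ-at-sparse-vertex {bigstar V'} {V'} {f} {v} {c} f-vc c∈V' ∣V'∣≤m λ {e} → neighbours∈V' e
      where
        neighbours∈V' : ∀ e {i} → e ∈E bigstar V' → Joins e v i → i ∈ V'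
        neighbours∈V' e e∈B (inj₁ (s≡v , t≡i)) =
          [ (λ s∈V' → contradiction (subst (_∈ V') s≡v s∈V') v∉V') , subst (_∈ V') t≡i ] (∈bigstar⁻ V' e e∈B)
        neighbours∈V' e e∈B (inj₂ (s≡i , t≡v)) =
          [ subst (_∈ V') s≡i , (λ t∈V' → contradiction (subst (_∈ V') t≡v t∈V') v∉V') ] (∈bigstar⁻ V' e e∈B)

    ∉σ-bigstar-─ : ∣ V' ∣ ≤ m → ∀ {f} → f ∈E bigstar V' → ¬ f ∈E K V' → ¬ f ∈E σ (bigstar V' ─E f)
    ∉σ-bigstar-─ ∣V'∣≤m {f} f∈B f∉K with src f ∈? V' | tgt f ∈? V'
    ... | yes s∈V' | yes t∈V' = contradiction (∈K⁺ V' f s∈V' t∈V') f∉K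
    ... | yes s∈V' | no t∉V' = ∉σ-bigstar-outer ∣V'∣≤m {f} (inj₂ (refl , refl)) t∉V' s∈V'
    ... | no s∉V' | yes t∈V' = ∉σ-bigstar-outer ∣V'∣≤m {f} (inj₁ (refl , refl)) s∉V' t∈V'
    ... | no s∉V' | no t∉V' = ⊥-elim ([ s∉V' , t∉V' ] (∈bigstar⁻ V' f f∈B))

    bigstar-independent : ∣ V' ∣ ≤ m → Independent A (bigstar V')
    bigstar-independent ∣V'∣≤m x x∈B with x ∈E? K V'
    ... | no x∉K = ∉σ-bigstar-─ ∣V'∣≤m x∈B x∉K
    ... | yes x∈K = ∉σ-─ A x∈B K-x⊆B others-free (∉σ-K-─ ∣V'∣≤m x∈K)
      where
        K-x⊆B : (K V' ─E x) ⊆E bigstar V'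
        K-x⊆B f f∈K-x = ∈bigstar⁺ V' f (inj₁ refl) (∈K⁻ V' f (proj₁ (∈─E⁻ (K V') f x f∈K-x)) (inj₁ refl))

        others-free : ∀ {f} → f ∈E (bigstar V' ─E x) → ¬ f ∈E (K V' ─E x) → ¬ f ∈E σ (bigstar V' ─E f)
        others-free {f} f∈B-x f∉K-x with ∈─E⁻ (bigstar V') f x f∈B-x
        ... | f∈B , f≢x = ∉σ-bigstar-─ ∣V'∣≤m f∈B λ f∈K → f∉K-x (∈─E⁺ (K V') f x f∈K f≢x)

mainTheorem5 : (m : ℕ) → 0 < m → (n : ℕ) → (A : Matroid n) →
    IsAbstractRigidityMatroid A m →
    (V' : Subset n) → ∣ V' ∣ ≡ m → Basis A (bigstar V')
mainTheorem5 m 0<m n A R V' ∣V'∣≡m =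
  bigstar-independent R {V'} (≤-reflexive ∣V'∣≡m) , bigstar-maximal R {V'} 0<m (≤-reflexive (sym ∣V'∣≡m))
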